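{- Let $u$ be a nonempty finite word over the positive integers and let $m=\max u$. Let $w$ be a word with $uw\equiv wu$, and let $P=P(w)$ have rows $R_1,R_2,\ldots$. If $u$ contains a (not necessarily consecutive) subsequence $m,m-1,\ldots,m-k+1$, then every entry of $R_i$ is at most $m$ for each $1\le i\le k$.
   Context: $P(v)$ denotes the RSK insertion tableau of a word $v$, with row $R_1$ the top row. Knuth equivalence $\equiv$: $v\equiv w$ iff $P(v)=P(w)$ (equivalently, one is obtained from the other by Knuth transpositions $xacby\leftrightarrow xcaby$ with $a\le b<c$ and $xbacy\leftrightarrow xbcay$ with $a<b\le c$). -}

module Defs where

open import Data.Nat using (ℕ; zero; suc; _≤_; _∸_; _≤ᵇ_; _⊔_)
open import Data.Bool using (if_then_else_)
open import Data.List using (List; []; _∷_; foldl; _++_)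
open import Data.Product using (_×_; _,_)
open import Data.Maybe using (Maybe; just; nothing)

-- A word is a list of natural numbers (positivity is imposed as a hypothesis).
Word : Set
Word = List ℕ

-- A tableau is its list of rows, top row R₁ first.
Tableau : Set
Tableau = List (List ℕ)

consFst : ℕ → List ℕ × Maybe ℕ → List ℕ × Maybe ℕ
consFst y (r , b) = (y ∷ r , b)

rowInsert : ℕ → List ℕ → List ℕ × Maybe ℕ
rowInsert x [] = (x ∷ [] , nothing)
rowInsert x (y ∷ ys) =
  if suc x ≤ᵇ y
  then (x ∷ ys , just y)
  else consFst y (rowInsert x ys)

insert : ℕ → Tableau → Tableau
insert x [] = (x ∷ []) ∷ []
insert x (r ∷ rs) with rowInsert x r
... | (r' , nothing) = r' ∷ rs
... | (r' , just y) = r' ∷ insert y rs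

P : Word → Tableau
P v = foldl (λ T x → insert x T) [] v

-- Knuth equivalence: v ≡ w iff P(v) = P(w).
open import Relation.Binary.PropositionalEquality using (_≡_)
_≡K_ : Word → Word → Set
v ≡K w = P v ≡ P w

maxW : Word → ℕ
maxW [] = 0
maxW (x ∷ xs) = x ⊔ maxW xs

descending : ℕ → ℕ → Word
descending m zero = []
descending m (suc k) = m ∷ descending (m ∸ 1) k

-- Row R_{i+1} of a tableau (0-indexed i); empty if the tableau has fewer rows.
row : ℕ → Tableau → List ℕ
row _ [] = []
row zero (r ∷ rs) = r
row (suc i) (r ∷ rs) = row i rs

-- Fix s = max u and let #bigRows s k T count the entries > s in the first k rows of T.
-- From below: a weakly increasing word inserted into a row leaves at least as many big
-- letters in the row as it brings, so inserting the reading word of T into any tableau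
-- yields at least #bigRows s k T big entries in the first k rows.  The reading word of P(w)
-- is Knuth equivalent to w, hence P(u) ← rd(P w) = P(uw) = P(wu) = P(w) ← u, and inserting u
-- into P(w) does not lower the count.  From above: u has no letter > s, and its run
-- s, s−1, …, s−k+1 descends through the first k rows losing one letter per row; in the first
-- row holding a big entry its head bumps a big letter below, so inserting u strictly lowers
-- a positive count.  Hence the count is 0.
module Submission where

open import Defs
open import Data.Nat using (ℕ; zero; suc; _≤_; _<_; _≤ᵇ_; _∸_; _⊔_; _+_; z≤n; s≤s; _<?_; _≤?_; _≟_)
open import Data.Nat.Properties
open import Data.Bool using (true; false; if_then_else_)
open import Data.List using (List; []; _∷_; _++_; [_]; foldl; fromMaybe)
open import Data.List.Properties using (++-assoc; ++-identityʳ; foldl-++)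
open import Data.Maybe using (Maybe; just; nothing)
open import Data.Maybe.Relation.Unary.All as Maybe using (just; nothing)
open import Data.Product using (_×_; _,_; proj₁; proj₂; ∃; ∃₂; map₁; map₂)
open import Data.Empty using (⊥-elim)
open import Function using (_∘_)
open import Relation.Nullary using (¬_; yes; no; contradiction)
open import Relation.Nullary.Reflects using (ofʸ; ofⁿ)
open import Relation.Binary.PropositionalEquality
  using (_≡_; _≢_; refl; sym; trans; cong; cong₂; subst; module ≡-Reasoning)
open import Data.List.Relation.Unary.All as All using (All; []; _∷_)
import Data.List.Relation.Unary.All.Properties as Allₚ
open import Data.List.Relation.Unary.AllPairs using (AllPairs; []; _∷_)
open import Data.List.Relation.Unary.Any as Any using (Any; here; there)
open import Data.List.Membership.Propositional using (_∈_)
open import Relation.Binary.Bundles using (Setoid)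
import Relation.Binary.Reasoning.Setoid as SetoidReasoning
open import Relation.Binary.Construct.Closure.Symmetric using (SymClosure; fwd; bwd; symmetric)
open import Relation.Binary.Construct.Closure.ReflexiveTransitive as Star using (Star; ε; _◅_)
open import Data.List.Relation.Binary.Sublist.Propositional using (_⊆_; _∷_; _∷ʳ_; minimum)
open import Data.List.Relation.Binary.Sublist.Propositional.Properties using (++⁺ˡ; All-resp-⊆)
open import Algebra.Properties.CommutativeSemigroup +-commutativeSemigroup
  using (xy∙z≈xz∙y; x∙yz≈xz∙y; xy∙z≈zy∙x; xy∙z≈x∙zy)

-- Row insertion

Sorted : List ℕ → Set
Sorted = AllPairs _≤_

data RowStep (x z : ℕ) (zs : List ℕ) : List ℕ × Maybe ℕ → Set where
  bumps  : x < z → RowStep x z zs (x ∷ zs , just z)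
  passes : z ≤ x → RowStep x z zs (consFst z (rowInsert x zs))

rowStep : ∀ x z zs → RowStep x z zs (rowInsert x (z ∷ zs))
rowStep x z zs with suc x ≤ᵇ z | ≤ᵇ-reflects-≤ (suc x) z
... | true  | ofʸ x<z = bumps x<z
... | false | ofⁿ x≮z = passes (≮⇒≥ x≮z)

rowInsert-bump : ∀ {x z} zs → x < z → rowInsert x (z ∷ zs) ≡ (x ∷ zs , just z)
rowInsert-bump {x} {z} zs x<z with rowInsert x (z ∷ zs) | rowStep x z zs
... | _ | bumps _    = refl
... | _ | passes z≤x = contradiction z≤x (<⇒≱ x<z)

rowInsert-pass : ∀ {x z} zs → z ≤ x → rowInsert x (z ∷ zs) ≡ consFst z (rowInsert x zs)
rowInsert-pass {x} {z} zs z≤x with rowInsert x (z ∷ zs) | rowStep x z zs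
... | _ | bumps x<z = contradiction z≤x (<⇒≱ x<z)
... | _ | passes _  = refl

rowInsert-All : ∀ {P : ℕ → Set} x R → All P R → P x → All P (proj₁ (rowInsert x R))
rowInsert-All x []       _          px = px ∷ []
rowInsert-All x (z ∷ zs) (pz ∷ pzs) px with rowInsert x (z ∷ zs) | rowStep x z zs
... | _ | bumps _  = px ∷ pzs
... | _ | passes _ = pz ∷ rowInsert-All x zs pzs px

bumped-All : ∀ {P : ℕ → Set} x R → All P R → Maybe.All P (proj₂ (rowInsert x R))
bumped-All x []       _          = nothing
bumped-All x (z ∷ zs) (pz ∷ pzs) with rowInsert x (z ∷ zs) | rowStep x z zs
... | _ | bumps _  = just pz
... | _ | passes _ = bumped-All x zs pzs

bumped-> : ∀ x R → Maybe.All (x <_) (proj₂ (rowInsert x R))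
bumped-> x []       = nothing
bumped-> x (z ∷ zs) with rowInsert x (z ∷ zs) | rowStep x z zs
... | _ | bumps x<z = just x<z
... | _ | passes _  = bumped-> x zs

rowInsert-sorted : ∀ x R → Sorted R → Sorted (proj₁ (rowInsert x R))
rowInsert-sorted x []       _              = [] ∷ []
rowInsert-sorted x (z ∷ zs) (z≤zs ∷ sorted) with rowInsert x (z ∷ zs) | rowStep x z zs
... | _ | bumps x<z  = All.map (≤-trans (<⇒≤ x<z)) z≤zs ∷ sorted
... | _ | passes z≤x = rowInsert-All x zs z≤zs z≤x ∷ rowInsert-sorted x zs sorted

∈-rowInsert : ∀ x R → x ∈ proj₁ (rowInsert x R)
∈-rowInsert x []       = here refl
∈-rowInsert x (z ∷ zs) with rowInsert x (z ∷ zs) | rowStep x z zs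
... | _ | bumps _  = here refl
... | _ | passes _ = there (∈-rowInsert x zs)

rowInsert-Any : ∀ {P : ℕ → Set} x R → Any P R →
                Maybe.All (¬_ ∘ P) (proj₂ (rowInsert x R)) → Any P (proj₁ (rowInsert x R))
rowInsert-Any x (z ∷ zs) p ¬pb with rowInsert x (z ∷ zs) | rowStep x z zs | p | ¬pb
... | _ | bumps _  | here pz  | just ¬pz = contradiction pz ¬pz
... | _ | bumps _  | there p′ | _        = there p′
... | _ | passes _ | here pz  | _        = here pz
... | _ | passes _ | there p′ | ¬pb′     = there (rowInsert-Any x zs p′ ¬pb′)

Any>⇒bumps : ∀ x R → Any (x <_) R → ∃ λ y → proj₂ (rowInsert x R) ≡ just y
Any>⇒bumps x (z ∷ zs) p with rowInsert x (z ∷ zs) | rowStep x z zs | p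
... | _ | bumps _    | _         = z , refl
... | _ | passes z≤x | here x<z  = contradiction z≤x (<⇒≱ x<z)
... | _ | passes _   | there p′ = Any>⇒bumps x zs p′

bumps-successor : ∀ a R → Sorted R → suc a ∈ R → proj₂ (rowInsert a R) ≡ just (suc a)
bumps-successor a (z ∷ zs) (z≤zs ∷ sorted) a+1∈R with rowInsert a (z ∷ zs) | rowStep a z zs | a+1∈R
... | _ | bumps _    | here refl     = refl
... | _ | bumps a<z  | there a+1∈zs = cong just (≤-antisym (All.lookup z≤zs a+1∈zs) a<z)
... | _ | passes a<a | here refl     = contradiction a<a (n≮n a)
... | _ | passes _   | there a+1∈zs = bumps-successor a zs sorted a+1∈zs

bumped-least : ∀ x R → Sorted R →
               Maybe.All (λ y → All (λ e → x < e → y ≤ e) R) (proj₂ (rowInsert x R))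
bumped-least x []       _              = nothing
bumped-least x (z ∷ zs) (z≤zs ∷ sorted) with rowInsert x (z ∷ zs) | rowStep x z zs
... | _ | bumps _    = just ((λ _ → ≤-refl) ∷ All.map (λ z≤e _ → z≤e) z≤zs)
... | _ | passes z≤x = Maybe.map ((λ x<z → contradiction z≤x (<⇒≱ x<z)) ∷_) (bumped-least x zs sorted)

no-bump⇒appended : ∀ x R → proj₂ (rowInsert x R) ≡ nothing →
                   All (_≤ x) R × proj₁ (rowInsert x R) ≡ R ++ [ x ]
no-bump⇒appended x []       _ = [] , refl
no-bump⇒appended x (z ∷ zs) eq with rowInsert x (z ∷ zs) | rowStep x z zs
... | _ | passes z≤x = map₁ (z≤x ∷_) (map₂ (cong (z ∷_)) (no-bump⇒appended x zs eq))

All≤⇒no-bump : ∀ x R → All (_≤ x) R → proj₂ (rowInsert x R) ≡ nothing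
All≤⇒no-bump x []       _           = refl
All≤⇒no-bump x (z ∷ zs) (z≤x ∷ zs≤x) = trans (cong proj₂ (rowInsert-pass zs z≤x)) (All≤⇒no-bump x zs zs≤x)

bump⇒split : ∀ x y R → proj₂ (rowInsert x R) ≡ just y →
             ∃₂ λ L H → R ≡ L ++ y ∷ H × proj₁ (rowInsert x R) ≡ L ++ x ∷ H × All (_≤ x) L × x < y
bump⇒split x y (z ∷ zs) eq with rowInsert x (z ∷ zs) | rowStep x z zs
bump⇒split x y (z ∷ zs) refl | _ | bumps x<z = [] , zs , refl , refl , [] , x<z
... | _ | passes z≤x with bump⇒split x y zs eq
...   | L , H , refl , eq′ , L≤x , x<y = z ∷ L , H , refl , cong (z ∷_) eq′ , z≤x ∷ L≤x , x<y

insertWord : Tableau → Word → Tableau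
insertWord = foldl (λ T x → insert x T)

insertWord-++ : ∀ T v w → insertWord T (v ++ w) ≡ insertWord (insertWord T v) w
insertWord-++ T v w = foldl-++ (λ T x → insert x T) T v w

rowInsertWord : List ℕ → Word → List ℕ × Word
rowInsertWord R []      = R , []
rowInsertWord R (x ∷ w) =
  map₂ (fromMaybe (proj₂ (rowInsert x R)) ++_) (rowInsertWord (proj₁ (rowInsert x R)) w)

insertWord-∷ : ∀ R T w →
  insertWord (R ∷ T) w ≡ proj₁ (rowInsertWord R w) ∷ insertWord T (proj₂ (rowInsertWord R w))
insertWord-∷ R T []      = refl
insertWord-∷ R T (x ∷ w) with rowInsert x R
... | R′ , nothing = insertWord-∷ R′ T w
... | R′ , just y  = insertWord-∷ R′ (insert y T) w

insert-sorted : ∀ x T → All Sorted T → All Sorted (insert x T)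
insert-sorted x []      _               = ([] ∷ []) ∷ []
insert-sorted x (R ∷ T) (sortedR ∷ sortedT) with rowInsert x R | rowInsert-sorted x R sortedR
... | R′ , nothing | sortedR′ = sortedR′ ∷ sortedT
... | R′ , just y  | sortedR′ = sortedR′ ∷ insert-sorted y T sortedT

insertWord-sorted : ∀ T w → All Sorted T → All Sorted (insertWord T w)
insertWord-sorted T []      sorted = sorted
insertWord-sorted T (x ∷ w) sorted = insertWord-sorted (insert x T) w (insert-sorted x T sorted)

-- Entries above a threshold

big : ℕ → ℕ → ℕ
big s x = if x ≤ᵇ s then 0 else 1

#big : ℕ → List ℕ → ℕ
#big s []       = 0
#big s (x ∷ xs) = big s x + #big s xs

#bigRows : ℕ → ℕ → Tableau → ℕ
#bigRows s zero    T       = 0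
#bigRows s (suc k) []      = 0
#bigRows s (suc k) (R ∷ T) = #big s R + #bigRows s k T

big-≤ : ∀ {s x} → x ≤ s → big s x ≡ 0
big-≤ {s} {x} x≤s with x ≤ᵇ s | ≤ᵇ-reflects-≤ x s
... | true  | _        = refl
... | false | ofⁿ x≰s = contradiction x≤s x≰s

big-> : ∀ {s x} → s < x → big s x ≡ 1
big-> {s} {x} s<x with x ≤ᵇ s | ≤ᵇ-reflects-≤ x s
... | true  | ofʸ x≤s = contradiction x≤s (<⇒≱ s<x)
... | false | _        = refl

#big-singleton>0 : ∀ {s y} → s < y → 0 < #big s [ y ]
#big-singleton>0 s<y = ≤-reflexive (sym (cong (_+ 0) (big-> s<y)))

#big-++ : ∀ s xs ys → #big s (xs ++ ys) ≡ #big s xs + #big s ys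
#big-++ s []       ys = refl
#big-++ s (x ∷ xs) ys = trans (cong (big s x +_) (#big-++ s xs ys)) (sym (+-assoc (big s x) _ _))

#big-rowInsert : ∀ s x R →
  #big s (proj₁ (rowInsert x R)) + #big s (fromMaybe (proj₂ (rowInsert x R))) ≡ #big s R + big s x
#big-rowInsert s x []       = trans (+-identityʳ _) (+-comm (big s x) 0)
#big-rowInsert s x (z ∷ zs) with rowInsert x (z ∷ zs) | rowStep x z zs
... | _ | bumps _  = trans (cong (big s x + #big s zs +_) (+-identityʳ (big s z)))
                           (xy∙z≈zy∙x (big s x) (#big s zs) (big s z))
... | _ | passes _ = trans (+-assoc (big s z) _ _)
                           (trans (cong (big s z +_) (#big-rowInsert s x zs)) (sym (+-assoc (big s z) _ _)))

#big-rowInsertWord : ∀ s R w →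
  #big s (proj₁ (rowInsertWord R w)) + #big s (proj₂ (rowInsertWord R w)) ≡ #big s R + #big s w
#big-rowInsertWord s R []      = refl
#big-rowInsertWord s R (x ∷ w) = begin
  #big s R″ + #big s (fromMaybe b ++ β)   ≡⟨ cong (#big s R″ +_) (#big-++ s (fromMaybe b) β) ⟩
  #big s R″ + (#big s (fromMaybe b) + #big s β) ≡⟨ x∙yz≈xz∙y (#big s R″) _ _ ⟩
  (#big s R″ + #big s β) + #big s (fromMaybe b) ≡⟨ cong (_+ #big s (fromMaybe b)) (#big-rowInsertWord s R′ w) ⟩
  (#big s R′ + #big s w) + #big s (fromMaybe b) ≡⟨ xy∙z≈xz∙y (#big s R′) _ _ ⟩
  (#big s R′ + #big s (fromMaybe b)) + #big s w ≡⟨ cong (_+ #big s w) (#big-rowInsert s x R) ⟩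
  (#big s R + big s x) + #big s w              ≡⟨ +-assoc (#big s R) _ _ ⟩
  #big s R + (big s x + #big s w)              ∎
  where
  open ≡-Reasoning
  R′ = proj₁ (rowInsert x R)
  b  = proj₂ (rowInsert x R)
  R″ = proj₁ (rowInsertWord R′ w)
  β  = proj₂ (rowInsertWord R′ w)

#bigRows-[] : ∀ s k → #bigRows s k [] ≡ 0
#bigRows-[] s zero    = refl
#bigRows-[] s (suc k) = refl

#bigRows-[]∷[] : ∀ s k → #bigRows s k ([] ∷ []) ≡ 0
#bigRows-[]∷[] s zero    = refl
#bigRows-[]∷[] s (suc k) = #bigRows-[] s k

#bigRows-insert : ∀ s k x T → #bigRows s k (insert x T) ≤ #bigRows s k T + big s x
#bigRows-insert s zero    x T       = z≤n
#bigRows-insert s (suc k) x []      = ≤-reflexive (begin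
  (big s x + 0) + #bigRows s k [] ≡⟨ cong₂ _+_ (+-identityʳ (big s x)) (#bigRows-[] s k) ⟩
  big s x + 0                      ≡⟨ +-identityʳ (big s x) ⟩
  big s x                          ∎)
  where open ≡-Reasoning
#bigRows-insert s (suc k) x (R ∷ T) with rowInsert x R | #big-rowInsert s x R
... | R′ , nothing | conserved = ≤-reflexive (begin
  #big s R′ + #bigRows s k T             ≡⟨ cong (_+ #bigRows s k T) (+-identityʳ (#big s R′)) ⟨
  (#big s R′ + 0) + #bigRows s k T       ≡⟨ cong (_+ #bigRows s k T) conserved ⟩
  (#big s R + big s x) + #bigRows s k T  ≡⟨ xy∙z≈xz∙y (#big s R) _ _ ⟩
  (#big s R + #bigRows s k T) + big s x  ∎)
  where open ≡-Reasoning
... | R′ , just y  | conserved = begin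
  #big s R′ + #bigRows s k (insert y T)         ≤⟨ +-monoʳ-≤ (#big s R′) (#bigRows-insert s k y T) ⟩
  #big s R′ + (#bigRows s k T + big s y)        ≡⟨ x∙yz≈xz∙y (#big s R′) _ _ ⟩
  (#big s R′ + big s y) + #bigRows s k T        ≡⟨ cong (λ n → (#big s R′ + n) + #bigRows s k T)
                                                        (+-identityʳ (big s y)) ⟨
  (#big s R′ + (big s y + 0)) + #bigRows s k T  ≡⟨ cong (_+ #bigRows s k T) conserved ⟩
  (#big s R + big s x) + #bigRows s k T         ≡⟨ xy∙z≈xz∙y (#big s R) _ _ ⟩
  (#big s R + #bigRows s k T) + big s x         ∎
  where open ≤-Reasoning

#bigRows-insertWord : ∀ s k T w → #bigRows s k (insertWord T w) ≤ #bigRows s k T + #big s w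
#bigRows-insertWord s k T []      = ≤-reflexive (sym (+-identityʳ _))
#bigRows-insertWord s k T (x ∷ w) = begin
  #bigRows s k (insertWord (insert x T) w) ≤⟨ #bigRows-insertWord s k (insert x T) w ⟩
  #bigRows s k (insert x T) + #big s w     ≤⟨ +-monoˡ-≤ (#big s w) (#bigRows-insert s k x T) ⟩
  (#bigRows s k T + big s x) + #big s w    ≡⟨ +-assoc (#bigRows s k T) _ _ ⟩
  #bigRows s k T + (big s x + #big s w)    ∎
  where open ≤-Reasoning

big-mono : ∀ {s s′} x → (s′ < x → s < x) → big s′ x ≤ big s x
big-mono {s′ = s′} x s′<⇒s< with x ≤? s′
... | yes x≤s′ = subst (_≤ _) (sym (big-≤ x≤s′)) z≤n
... | no  x≰s′ = ≤-reflexive (trans (big-> (≰⇒> x≰s′)) (sym (big-> (s′<⇒s< (≰⇒> x≰s′)))))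

#big-antitone : ∀ {s s′} → s ≤ s′ → ∀ R → #big s′ R ≤ #big s R
#big-antitone s≤s′ []      = z≤n
#big-antitone s≤s′ (x ∷ R) = +-mono-≤ (big-mono x (≤-<-trans s≤s′)) (#big-antitone s≤s′ R)

#big-bumped-⊔ : ∀ s {x} b → Maybe.All (x <_) b → #big s (fromMaybe b) ≤ #big (s ⊔ x) (fromMaybe b)
#big-bumped-⊔ s nothing  _          = z≤n
#big-bumped-⊔ s (just y) (just x<y) = +-monoˡ-≤ 0 (big-mono y (λ s<y → ⊔-lub s<y x<y))

-- The threshold s ⊔ t strengthens the induction; only t = 0 is needed.
#big-bumpedWord : ∀ s t R c → Sorted c → All (t ≤_) c →
                  #big s (proj₂ (rowInsertWord R c)) ≤ #big (s ⊔ t) R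
#big-bumpedWord s t R []      _               _         = z≤n
#big-bumpedWord s t R (x ∷ c) (x≤c ∷ sortedc) (t≤x ∷ _) = begin
  #big s (fromMaybe b ++ β)                     ≡⟨ #big-++ s (fromMaybe b) β ⟩
  #big s (fromMaybe b) + #big s β               ≤⟨ +-mono-≤ (#big-bumped-⊔ s b (bumped-> x R))
                                                            (#big-bumpedWord s x R′ c sortedc x≤c) ⟩
  #big (s ⊔ x) (fromMaybe b) + #big (s ⊔ x) R′  ≡⟨ +-comm (#big (s ⊔ x) (fromMaybe b)) _ ⟩
  #big (s ⊔ x) R′ + #big (s ⊔ x) (fromMaybe b)  ≡⟨ #big-rowInsert (s ⊔ x) x R ⟩
  #big (s ⊔ x) R + big (s ⊔ x) x                ≡⟨ cong (#big (s ⊔ x) R +_) (big-≤ (m≤n⊔m s x)) ⟩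
  #big (s ⊔ x) R + 0                            ≡⟨ +-identityʳ _ ⟩
  #big (s ⊔ x) R                                ≤⟨ #big-antitone (⊔-monoʳ-≤ s t≤x) R ⟩
  #big (s ⊔ t) R                                ∎
  where
  open ≤-Reasoning
  R′ = proj₁ (rowInsert x R)
  b  = proj₂ (rowInsert x R)
  β  = proj₂ (rowInsertWord R′ c)

bumpedWord-≥ : ∀ y t R c → Sorted c → All (t ≤_) c → All (λ e → t < e → y ≤ e) R →
               All (y ≤_) (proj₂ (rowInsertWord R c))
bumpedWord-≥ y t R []      _               _         _   = []
bumpedWord-≥ y t R (x ∷ c) (x≤c ∷ sortedc) (t≤x ∷ _) inv =
  Allₚ.++⁺ (head (bumped-All x R inv) (bumped-> x R)) (bumpedWord-≥ y x R′ c sortedc x≤c inv′)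
  where
  R′ = proj₁ (rowInsert x R)
  inv′ : All (λ e → x < e → y ≤ e) R′
  inv′ = rowInsert-All x R (All.map (λ f x<e → f (≤-<-trans t≤x x<e)) inv) (⊥-elim ∘ n≮n x)
  head : ∀ {b} → Maybe.All (λ e → t < e → y ≤ e) b → Maybe.All (x <_) b → All (y ≤_) (fromMaybe b)
  head nothing   _          = []
  head (just f) (just x<e) = f (≤-<-trans t≤x x<e) ∷ []

bumpedWord-sorted : ∀ R c → Sorted R → Sorted c → Sorted (proj₂ (rowInsertWord R c))
bumpedWord-sorted R []      _       _               = []
bumpedWord-sorted R (x ∷ c) sortedR (x≤c ∷ sortedc) = prepend (bumped-least x R sortedR)
  where
  R′ = proj₁ (rowInsert x R)
  β  = proj₂ (rowInsertWord R′ c)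
  prepend : ∀ {b} → Maybe.All (λ y → All (λ e → x < e → y ≤ e) R) b → Sorted (fromMaybe b ++ β)
  prepend nothing    = bumpedWord-sorted R′ c (rowInsert-sorted x R sortedR) sortedc
  prepend (just {y} least) =
    bumpedWord-≥ y x R′ c sortedc x≤c (rowInsert-All x R least (⊥-elim ∘ n≮n x))
    ∷ bumpedWord-sorted R′ c (rowInsert-sorted x R sortedR) sortedc

#big-≤-rowInsertWord : ∀ s R c → Sorted c → #big s c ≤ #big s (proj₁ (rowInsertWord R c))
#big-≤-rowInsertWord s R c sortedc = +-cancelˡ-≤ (#big s R) _ _ (begin
  #big s R + #big s c   ≡⟨ sym (#big-rowInsertWord s R c) ⟩
  #big s R′ + #big s β  ≤⟨ +-monoʳ-≤ (#big s R′) β≤R ⟩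
  #big s R′ + #big s R  ≡⟨ +-comm (#big s R′) _ ⟩
  #big s R + #big s R′  ∎)
  where
  open ≤-Reasoning
  R′ = proj₁ (rowInsertWord R c)
  β  = proj₂ (rowInsertWord R c)
  β≤R : #big s β ≤ #big s R
  β≤R = subst (λ t → #big s β ≤ #big t R) (⊔-identityʳ s)
              (#big-bumpedWord s 0 R c sortedc (All.universal (λ _ → z≤n) c))

mutual
  #bigRows-insertRow : ∀ s k T c → All Sorted T → Sorted c →
                       #bigRows s k T + #big s c ≤ #bigRows s (suc k) (insertWord T c)
  #bigRows-insertRow s k []      []      _                   _       =
    ≤-reflexive (trans (+-identityʳ _) (#bigRows-[] s k))
  #bigRows-insertRow s k []      (x ∷ c) _                   sortedc =
    -- insert x [] and insert x ([] ∷ []) coincide.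
    subst (λ n → n + #big s (x ∷ c) ≤ #bigRows s (suc k) (insertWord [] (x ∷ c)))
          (trans (#bigRows-[]∷[] s k) (sym (#bigRows-[] s k)))
          (#bigRows-insertRow-∷ s k [] [] (x ∷ c) [] [] sortedc)
  #bigRows-insertRow s k (R ∷ T) c       (sortedR ∷ sortedT) sortedc =
    #bigRows-insertRow-∷ s k R T c sortedR sortedT sortedc

  #bigRows-insertRow-∷ : ∀ s k R T c → Sorted R → All Sorted T → Sorted c →
                         #bigRows s k (R ∷ T) + #big s c ≤ #bigRows s (suc k) (insertWord (R ∷ T) c)
  #bigRows-insertRow-∷ s zero    R T c sortedR sortedT sortedc rewrite insertWord-∷ R T c =
    ≤-trans (#big-≤-rowInsertWord s R c sortedc) (≤-reflexive (sym (+-identityʳ _)))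
  #bigRows-insertRow-∷ s (suc j) R T c sortedR sortedT sortedc rewrite insertWord-∷ R T c = begin
    (#big s R + #bigRows s j T) + #big s c           ≡⟨ xy∙z≈xz∙y (#big s R) _ _ ⟩
    (#big s R + #big s c) + #bigRows s j T           ≡⟨ cong (_+ #bigRows s j T) (#big-rowInsertWord s R c) ⟨
    (#big s R′ + #big s β) + #bigRows s j T          ≡⟨ xy∙z≈x∙zy (#big s R′) _ _ ⟩
    #big s R′ + (#bigRows s j T + #big s β)          ≤⟨ +-monoʳ-≤ (#big s R′) (#bigRows-insertRow s j T β sortedT
                                                                              (bumpedWord-sorted R c sortedR sortedc)) ⟩
    #big s R′ + #bigRows s (suc j) (insertWord T β)  ∎
    where
    open ≤-Reasoning
    R′ = proj₁ (rowInsertWord R c)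
    β  = proj₂ (rowInsertWord R c)

readingWord : Tableau → Word
readingWord []      = []
readingWord (R ∷ T) = readingWord T ++ R

#bigRows-readingWord : ∀ s k X T → All Sorted X → All Sorted T →
                       #bigRows s k T ≤ #bigRows s k (insertWord X (readingWord T))
#bigRows-readingWord s k       X []      _       _                   =
  subst (_≤ #bigRows s k X) (sym (#bigRows-[] s k)) z≤n
#bigRows-readingWord s zero    X (R ∷ T) _       _                   = z≤n
#bigRows-readingWord s (suc k) X (R ∷ T) sortedX (sortedR ∷ sortedT) = begin
  #big s R + #bigRows s k T                               ≤⟨ +-monoʳ-≤ (#big s R)
                                                               (#bigRows-readingWord s k X T sortedX sortedT) ⟩
  #big s R + #bigRows s k Y                               ≡⟨ +-comm (#big s R) _ ⟩
  #bigRows s k Y + #big s R                               ≤⟨ #bigRows-insertRow s k Y R sortedY sortedR ⟩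
  #bigRows s (suc k) (insertWord Y R)                     ≡⟨ cong (#bigRows s (suc k))
                                                                  (insertWord-++ X (readingWord T) R) ⟨
  #bigRows s (suc k) (insertWord X (readingWord T ++ R))  ∎
  where
  open ≤-Reasoning
  Y = insertWord X (readingWord T)
  sortedY = insertWord-sorted X (readingWord T) sortedX

-- Descending runs

-- Inserting a ∸ 1 into a row containing a bumps a, so a descending run of the inserted
-- word reappears, one letter shorter, in the bumped word.  The bound j ≤ a keeps the run
-- away from the truncation 0 ∸ 1 = 0.
mutual
  descending-bumpedWord-∈ : ∀ j a X c → Sorted X → j ≤ a → a ∈ X →
                            descending (a ∸ 1) j ⊆ c → descending a j ⊆ proj₂ (rowInsertWord X c)
  descending-bumpedWord-∈ zero    a       X c       _       _         _   _ = minimum _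
  descending-bumpedWord-∈ (suc j) (suc a) X (x ∷ c) sortedX (s≤s j≤a) a∈X (refl ∷ run)
    rewrite bumps-successor a X sortedX a∈X =
    refl ∷ descending-bumpedWord-∈ j a (proj₁ (rowInsert a X)) c (rowInsert-sorted a X sortedX) j≤a
                                   (∈-rowInsert a X) run
  descending-bumpedWord-∈ (suc j) a       X (x ∷ c) sortedX j≤a       a∈X (x ∷ʳ run)
    with rowInsert x X | rowInsert-sorted x X sortedX | rowInsert-Any {a ≡_} x X a∈X
  ... | X′ , nothing | sortedX′ | a∈X′ =
    descending-bumpedWord-∈ (suc j) a X′ c sortedX′ j≤a (a∈X′ nothing) run
  ... | X′ , just b  | sortedX′ | a∈X′ with a ≟ b
  ...   | yes refl = refl ∷ descending-bumpedWord j (a ∸ 1) X′ c sortedX′ (∸-monoˡ-≤ 1 j≤a) run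
  ...   | no  a≢b  = b ∷ʳ descending-bumpedWord-∈ (suc j) a X′ c sortedX′ j≤a (a∈X′ (just a≢b)) run

  descending-bumpedWord : ∀ j a X c → Sorted X → j ≤ a →
                          descending a (suc j) ⊆ c → descending a j ⊆ proj₂ (rowInsertWord X c)
  descending-bumpedWord j a X (x ∷ c) sortedX j≤a (refl ∷ run) =
    ++⁺ˡ (fromMaybe (proj₂ (rowInsert a X)))
         (descending-bumpedWord-∈ j a (proj₁ (rowInsert a X)) c (rowInsert-sorted a X sortedX) j≤a
                                  (∈-rowInsert a X) run)
  descending-bumpedWord j a X (x ∷ c) sortedX j≤a (x ∷ʳ run) =
    ++⁺ˡ (fromMaybe (proj₂ (rowInsert x X)))
         (descending-bumpedWord j a (proj₁ (rowInsert x X)) c (rowInsert-sorted x X sortedX) j≤a run)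

bumpedWord-split : ∀ m j X c → Sorted X → j ≤ m → Any (m <_) X → descending m (suc j) ⊆ c →
                   ∃₂ λ β₀ β₁ → proj₂ (rowInsertWord X c) ≡ β₀ ++ β₁ × 0 < #big m β₀ × descending m j ⊆ β₁
bumpedWord-split m j X (x ∷ c) sortedX j≤m big∈X (refl ∷ run)
  with rowInsert m X | Any>⇒bumps m X big∈X | bumped-> m X | ∈-rowInsert m X | rowInsert-sorted m X sortedX
... | X′ , just y | _ , refl | just m<y | m∈X′ | sortedX′ =
  [ y ] , _ , refl , #big-singleton>0 m<y ,
  descending-bumpedWord-∈ j m X′ c sortedX′ j≤m m∈X′ run
bumpedWord-split m j X (x ∷ c) sortedX j≤m big∈X (x ∷ʳ run)
  with rowInsert x X | rowInsert-sorted x X sortedX | rowInsert-Any {m <_} x X big∈X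
... | X′ , nothing | sortedX′ | big∈X′ = bumpedWord-split m j X′ c sortedX′ j≤m (big∈X′ nothing) run
... | X′ , just b  | sortedX′ | big∈X′ with m <? b
...   | yes m<b = [ b ] , _ , refl , #big-singleton>0 m<b , descending-bumpedWord j m X′ c sortedX′ j≤m run
...   | no  m≮b with bumpedWord-split m j X′ c sortedX′ j≤m (big∈X′ (just m≮b)) run
...     | β₀ , β₁ , split , big∈β₀ , run′ =
  b ∷ β₀ , β₁ , cong (b ∷_) split , ≤-trans big∈β₀ (m≤n+m _ _) , run′

#big-Any : ∀ s R → 0 < #big s R → Any (s <_) R
#big-Any s (x ∷ R) pos with x ≤? s
... | yes x≤s = there (#big-Any s R (subst (λ n → 0 < n + #big s R) (big-≤ x≤s) pos))
... | no  x≰s = here (≰⇒> x≰s)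

-- If a lower row holds a big entry, induct on the bumped word.  Otherwise the first row
-- holds one, and the head m of the run bumps a big letter ahead of the rest of the run.
mutual
  #bigRows-insertWord-< : ∀ m k T c → All Sorted T → k ≤ m → descending m k ⊆ c →
                          0 < #bigRows m k T → #bigRows m k (insertWord T c) < #bigRows m k T + #big m c
  #bigRows-insertWord-< m (suc j) (R ∷ T) c (sortedR ∷ sortedT) k≤m run pos
    rewrite insertWord-∷ R T c = begin-strict
    #big m R′ + #bigRows m j (insertWord T β) <⟨ +-monoʳ-< (#big m R′) lower-rows ⟩
    #big m R′ + (#bigRows m j T + #big m β)  ≡⟨ x∙yz≈xz∙y (#big m R′) _ _ ⟩
    (#big m R′ + #big m β) + #bigRows m j T  ≡⟨ cong (_+ #bigRows m j T) (#big-rowInsertWord m R c) ⟩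
    (#big m R + #big m c) + #bigRows m j T   ≡⟨ xy∙z≈xz∙y (#big m R) _ _ ⟩
    (#big m R + #bigRows m j T) + #big m c   ∎
    where
    open ≤-Reasoning
    R′ = proj₁ (rowInsertWord R c)
    β  = proj₂ (rowInsertWord R c)
    j≤m = ≤-trans (n≤1+n j) k≤m
    big∈R : #bigRows m j T ≡ 0 → Any (m <_) R
    big∈R none = #big-Any m R (≤-trans pos (≤-reflexive (trans (cong (#big m R +_) none) (+-identityʳ _))))
    lower-rows-empty : #bigRows m j T ≡ 0 → #bigRows m j (insertWord T β) < #big m β
    lower-rows-empty none with bumpedWord-split m j R c sortedR j≤m (big∈R none) run
    ... | β₀ , β₁ , split , big∈β₀ , run′ rewrite split | insertWord-++ T β₀ β₁ | #big-++ m β₀ β₁ =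
      #bigRows-insertWord-<-bound m j (insertWord T β₀) β₁ (insertWord-sorted T β₀ sortedT) j≤m run′
        (≤-trans (#bigRows-insertWord m j T β₀) (≤-reflexive (cong (_+ #big m β₀) none))) big∈β₀
    lower-rows : #bigRows m j (insertWord T β) < #bigRows m j T + #big m β
    lower-rows with 0 <? #bigRows m j T
    ... | yes pos′ =
      #bigRows-insertWord-< m j T β sortedT j≤m (descending-bumpedWord j m R c sortedR j≤m run) pos′
    ... | no  ¬pos′ =
      subst (λ d → #bigRows m j (insertWord T β) < d + #big m β) (sym none) (lower-rows-empty none)
      where none = n≤0⇒n≡0 (≮⇒≥ ¬pos′)

  #bigRows-insertWord-<-bound : ∀ m k T c {n} → All Sorted T → k ≤ m → descending m k ⊆ c →
                                #bigRows m k T ≤ n → 0 < n → #bigRows m k (insertWord T c) < n + #big m c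
  #bigRows-insertWord-<-bound m k T c sortedT k≤m run bound pos with 0 <? #bigRows m k T
  ... | yes pos′  = <-≤-trans (#bigRows-insertWord-< m k T c sortedT k≤m run pos′)
                             (+-monoˡ-≤ (#big m c) bound)
  ... | no  ¬pos′ = ≤-<-trans (#bigRows-insertWord m k T c)
                             (+-monoˡ-< (#big m c) (≤-<-trans (≮⇒≥ ¬pos′) pos))

-- Knuth moves

-- The elementary Knuth transformations with their context x, y stripped; move⇒≃ and
-- ≃-++ˡ restore it.
data KnuthMove : Word → Word → Set where
  acb~cab : ∀ {a b c} → a ≤ b → b < c → KnuthMove (a ∷ c ∷ b ∷ []) (c ∷ a ∷ b ∷ [])
  bac~bca : ∀ {a b c} → a < b → b ≤ c → KnuthMove (b ∷ a ∷ c ∷ []) (b ∷ c ∷ a ∷ [])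

infix 4 _≈ᴷ_ _≈ᴿ_
_≈ᴷ_ : Word → Word → Set
_≈ᴷ_ = Star (SymClosure KnuthMove)

_≈ᴿ_ : List ℕ × Word → List ℕ × Word → Set
(R , β) ≈ᴿ (R′ , β′) = R ≡ R′ × β ≈ᴷ β′

≈ᴿ-sym : ∀ {p q} → p ≈ᴿ q → q ≈ᴿ p
≈ᴿ-sym (R≡R′ , β≈β′) = sym R≡R′ , Star.reverse (symmetric KnuthMove) β≈β′

move⇒≈ᴷ : ∀ {u v} → KnuthMove u v → u ≈ᴷ v
move⇒≈ᴷ m = fwd m ◅ ε

rowInsertWord-passAll : ∀ z zs w → All (z ≤_) w →
                        rowInsertWord (z ∷ zs) w ≡ map₁ (z ∷_) (rowInsertWord zs w)
rowInsertWord-passAll z zs []      _           = refl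
rowInsertWord-passAll z zs (x ∷ w) (z≤x ∷ z≤w) rewrite rowInsert-pass zs z≤x =
  cong (map₂ (fromMaybe (proj₂ (rowInsert x zs)) ++_))
       (rowInsertWord-passAll z (proj₁ (rowInsert x zs)) w z≤w)

rowInsertWord-[]-move : ∀ {u v} → KnuthMove u v → rowInsertWord [] u ≡ rowInsertWord [] v
rowInsertWord-[]-move (acb~cab {a} {b} {c} a≤b b<c)
  rewrite rowInsert-pass [] (≤-trans a≤b (<⇒≤ b<c)) | rowInsert-pass (c ∷ []) a≤b | rowInsert-bump [] b<c
        | rowInsert-bump [] (≤-<-trans a≤b b<c) | rowInsert-pass [] a≤b = refl
rowInsertWord-[]-move (bac~bca {a} {b} {c} a<b b≤c)
  rewrite rowInsert-bump [] a<b | rowInsert-pass [] (≤-trans (<⇒≤ a<b) b≤c) | rowInsert-pass [] b≤c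
        | rowInsert-bump (c ∷ []) a<b = refl

rowInsertWord-lift : ∀ z zs {u v} → All (z ≤_) u → All (z ≤_) v →
  rowInsertWord zs u ≈ᴿ rowInsertWord zs v → rowInsertWord (z ∷ zs) u ≈ᴿ rowInsertWord (z ∷ zs) v
rowInsertWord-lift z zs {u} {v} z≤u z≤v (R≡R′ , β≈β′)
  rewrite rowInsertWord-passAll z zs u z≤u | rowInsertWord-passAll z zs v z≤v = cong (z ∷_) R≡R′ , β≈β′

rowInsertWord-acb~cab-mid : ∀ {a b c z} zs → Sorted (z ∷ zs) → a ≤ b → b < c → a < z → z ≤ c →
  rowInsertWord (z ∷ zs) (a ∷ c ∷ b ∷ []) ≈ᴿ rowInsertWord (z ∷ zs) (c ∷ a ∷ b ∷ [])
rowInsertWord-acb~cab-mid {a} {b} {c} {z} zs (z≤zs ∷ sorted) a≤b b<c a<z z≤c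
  rewrite rowInsert-bump zs a<z | rowInsert-pass zs (≤-trans a≤b (<⇒≤ b<c)) | rowInsert-pass zs z≤c
        | rowInsert-bump (proj₁ (rowInsert c zs)) a<z | rowInsert-pass (proj₁ (rowInsert c zs)) a≤b
  = refl , bumped≈
  where
  zs′ = proj₁ (rowInsert c zs)
  bumped≈ : (z ∷ fromMaybe (proj₂ (rowInsert c zs)) ++ fromMaybe (proj₂ (rowInsert b zs′)) ++ [])
         ≈ᴷ (fromMaybe (proj₂ (rowInsert c zs)) ++ z ∷ fromMaybe (proj₂ (rowInsert b zs′)) ++ [])
  bumped≈ with proj₂ (rowInsert b zs′) | Any>⇒bumps b zs′ (Any.map (λ { refl → b<c }) (∈-rowInsert c zs))
             | bumped-least b zs′ (rowInsert-sorted c zs sorted)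
             | bumped-All b zs′ (rowInsert-All c zs z≤zs z≤c)
  ... | just δ | _ , refl | just δ-least | just z≤δ with proj₂ (rowInsert c zs) | bumped-> c zs
  ...   | nothing | _        = ε
  ...   | just γ  | just c<γ =
    move⇒≈ᴷ (acb~cab z≤δ (≤-<-trans (All.lookup δ-least (∈-rowInsert c zs) b<c) c<γ))

rowInsertWord-acb~cab-high : ∀ {a b c z} zs → Sorted (z ∷ zs) → a ≤ b → b < c → c < z →
  rowInsertWord (z ∷ zs) (a ∷ c ∷ b ∷ []) ≈ᴿ rowInsertWord (z ∷ zs) (c ∷ a ∷ b ∷ [])
rowInsertWord-acb~cab-high {a} {b} {c} {z} [] _ a≤b b<c c<z
  rewrite rowInsert-bump [] (<-trans (≤-<-trans a≤b b<c) c<z)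
        | rowInsert-pass [] (≤-trans a≤b (<⇒≤ b<c)) | rowInsert-pass (c ∷ []) a≤b | rowInsert-bump [] b<c
        | rowInsert-bump [] c<z | rowInsert-bump [] (≤-<-trans a≤b b<c) | rowInsert-pass [] a≤b
  = refl , ε
rowInsertWord-acb~cab-high {a} {b} {c} {z} (z′ ∷ zs) ((z≤z′ ∷ _) ∷ _) a≤b b<c c<z
  rewrite rowInsert-bump (z′ ∷ zs) c<z | rowInsert-bump (z′ ∷ zs) (≤-<-trans a≤b b<c)
        | rowInsert-pass (z′ ∷ zs) a≤b | rowInsert-bump zs (<-trans b<c (<-≤-trans c<z z≤z′))
        | rowInsert-bump (z′ ∷ zs) (<-trans (≤-<-trans a≤b b<c) c<z)
        | rowInsert-pass (z′ ∷ zs) (≤-trans a≤b (<⇒≤ b<c)) | rowInsert-bump zs (<-≤-trans c<z z≤z′)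
        | rowInsert-pass (c ∷ zs) a≤b | rowInsert-bump zs b<c
  = refl , bwd (bac~bca c<z z≤z′) ◅ ε

rowInsertWord-bac~bca-mid : ∀ {a b c z} zs → Sorted (z ∷ zs) → a < b → b ≤ c → a < z → z ≤ b →
  rowInsertWord (z ∷ zs) (b ∷ a ∷ c ∷ []) ≈ᴿ rowInsertWord (z ∷ zs) (b ∷ c ∷ a ∷ [])
rowInsertWord-bac~bca-mid {a} {b} {c} {z} zs (z≤zs ∷ sorted) a<b b≤c a<z z≤b
  rewrite rowInsert-pass zs z≤b | rowInsert-bump (proj₁ (rowInsert b zs)) a<z
        | rowInsert-pass (proj₁ (rowInsert b zs)) (≤-trans (<⇒≤ a<b) b≤c)
        | rowInsert-pass (proj₁ (rowInsert b zs)) (≤-trans z≤b b≤c)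
        | rowInsert-bump (proj₁ (rowInsert c (proj₁ (rowInsert b zs)))) a<z
  = refl , bumped≈
  where
  zs′ = proj₁ (rowInsert b zs)
  bumped≈ : (fromMaybe (proj₂ (rowInsert b zs)) ++ z ∷ fromMaybe (proj₂ (rowInsert c zs′)) ++ [])
         ≈ᴷ (fromMaybe (proj₂ (rowInsert b zs)) ++ fromMaybe (proj₂ (rowInsert c zs′)) ++ z ∷ [])
  bumped≈ with proj₂ (rowInsert b zs) in no-β | bumped-> b zs | bumped-least b zs sorted
  ... | nothing | _ | _
    rewrite All≤⇒no-bump c zs′ (rowInsert-All b zs (All.map (λ e≤b → ≤-trans e≤b b≤c)
                                                            (proj₁ (no-bump⇒appended b zs no-β))) b≤c)
    = ε
  ... | just β | just b<β | just β-least
    with proj₂ (rowInsert c zs′) | bumped-> c zs′ | bumped-All c zs′ (rowInsert-All b zs β-least (⊥-elim ∘ n≮n b))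
  ...   | nothing | _        | _              = ε
  ...   | just γ  | just c<γ | just β-least-γ =
    move⇒≈ᴷ (bac~bca (≤-<-trans z≤b b<β) (β-least-γ (≤-<-trans b≤c c<γ)))

rowInsertWord-bac~bca-high : ∀ {a b c z} zs → Sorted (z ∷ zs) → a < b → b ≤ c → b < z →
  rowInsertWord (z ∷ zs) (b ∷ a ∷ c ∷ []) ≈ᴿ rowInsertWord (z ∷ zs) (b ∷ c ∷ a ∷ [])
rowInsertWord-bac~bca-high {a} {b} {c} {z} zs (z≤zs ∷ _) a<b b≤c b<z
  rewrite rowInsert-bump zs b<z | rowInsert-bump zs a<b | rowInsert-pass zs (≤-trans (<⇒≤ a<b) b≤c)
        | rowInsert-pass zs b≤c | rowInsert-bump (proj₁ (rowInsert c zs)) a<b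
  = refl , bumped≈
  where
  bumped≈ : (z ∷ b ∷ fromMaybe (proj₂ (rowInsert c zs)) ++ [])
         ≈ᴷ (z ∷ fromMaybe (proj₂ (rowInsert c zs)) ++ b ∷ [])
  bumped≈ with proj₂ (rowInsert c zs) | bumped-All c zs z≤zs
  ... | nothing | _          = ε
  ... | just γ  | just z≤γ = move⇒≈ᴷ (bac~bca b<z z≤γ)

rowInsertWord-move : ∀ Z {u v} → Sorted Z → KnuthMove u v → rowInsertWord Z u ≈ᴿ rowInsertWord Z v
rowInsertWord-move [] {u} _ m = subst (rowInsertWord [] u ≈ᴿ_) (rowInsertWord-[]-move m) (refl , ε)
rowInsertWord-move (z ∷ zs) sorted@(_ ∷ sorted′) (acb~cab {a} {b} {c} a≤b b<c) with z ≤? a | z ≤? c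
... | yes z≤a | _        = rowInsertWord-lift z zs (z≤a ∷ z≤c ∷ z≤b ∷ []) (z≤c ∷ z≤a ∷ z≤b ∷ [])
                                              (rowInsertWord-move zs sorted′ (acb~cab a≤b b<c))
  where
  z≤b = ≤-trans z≤a a≤b
  z≤c = ≤-trans z≤b (<⇒≤ b<c)
... | no z≰a | yes z≤c = rowInsertWord-acb~cab-mid zs sorted a≤b b<c (≰⇒> z≰a) z≤c
... | no _   | no z≰c  = rowInsertWord-acb~cab-high zs sorted a≤b b<c (≰⇒> z≰c)
rowInsertWord-move (z ∷ zs) sorted@(_ ∷ sorted′) (bac~bca {a} {b} {c} a<b b≤c) with z ≤? a | z ≤? b
... | yes z≤a | _        = rowInsertWord-lift z zs (z≤b ∷ z≤a ∷ z≤c ∷ []) (z≤b ∷ z≤c ∷ z≤a ∷ [])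
                                              (rowInsertWord-move zs sorted′ (bac~bca a<b b≤c))
  where
  z≤b = ≤-trans z≤a (<⇒≤ a<b)
  z≤c = ≤-trans z≤b b≤c
... | no z≰a | yes z≤b = rowInsertWord-bac~bca-mid zs sorted a<b b≤c (≰⇒> z≰a) z≤b
... | no _   | no z≰b  = rowInsertWord-bac~bca-high zs sorted a<b b≤c (≰⇒> z≰b)

insertWord-[]-cong : ∀ {x y u v} → rowInsertWord [] (x ∷ u) ≡ rowInsertWord [] (y ∷ v) →
                     insertWord [] (x ∷ u) ≡ insertWord [] (y ∷ v)
insertWord-[]-cong {x} {y} {u} {v} eq =
  -- insertWord [] (x ∷ u) = insertWord ([] ∷ []) (x ∷ u).
  trans (insertWord-∷ [] [] (x ∷ u))
        (trans (cong (λ q → proj₁ q ∷ insertWord [] (proj₂ q)) eq) (sym (insertWord-∷ [] [] (y ∷ v))))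

rowInsertWord-resp-move : ∀ R {u v} → Sorted R → SymClosure KnuthMove u v →
                          rowInsertWord R u ≈ᴿ rowInsertWord R v
rowInsertWord-resp-move R sorted (fwd m) = rowInsertWord-move R sorted m
rowInsertWord-resp-move R sorted (bwd m) = ≈ᴿ-sym (rowInsertWord-move R sorted m)

insertWord-[]-move : ∀ {u v} → KnuthMove u v → insertWord [] u ≡ insertWord [] v
insertWord-[]-move {a ∷ u} {c ∷ v} m@(acb~cab _ _) =
  insertWord-[]-cong {a} {c} {u} {v} (rowInsertWord-[]-move m)
insertWord-[]-move {b ∷ u} {b ∷ v} m@(bac~bca _ _) =
  insertWord-[]-cong {b} {b} {u} {v} (rowInsertWord-[]-move m)

mutual
  insertWord-resp-≈ᴷ : ∀ T {u v} → All Sorted T → u ≈ᴷ v → insertWord T u ≡ insertWord T v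
  insertWord-resp-≈ᴷ T sorted ε        = refl
  insertWord-resp-≈ᴷ T sorted (m ◅ ms) =
    trans (insertWord-resp-move T sorted m) (insertWord-resp-≈ᴷ T sorted ms)

  insertWord-resp-move : ∀ T {u v} → All Sorted T → SymClosure KnuthMove u v → insertWord T u ≡ insertWord T v
  insertWord-resp-move []      _                   (fwd m) = insertWord-[]-move m
  insertWord-resp-move []      _                   (bwd m) = sym (insertWord-[]-move m)
  insertWord-resp-move (R ∷ T) {u} {v} (sortedR ∷ sortedT) m
    with row≡ , bumped≈ ← rowInsertWord-resp-move R sortedR m = begin
    insertWord (R ∷ T) u                                                  ≡⟨ insertWord-∷ R T u ⟩
    proj₁ (rowInsertWord R u) ∷ insertWord T (proj₂ (rowInsertWord R u))  ≡⟨ cong₂ _∷_ row≡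
                                                                                   (insertWord-resp-≈ᴷ T sortedT bumped≈) ⟩
    proj₁ (rowInsertWord R v) ∷ insertWord T (proj₂ (rowInsertWord R v))  ≡⟨ insertWord-∷ R T v ⟨
    insertWord (R ∷ T) v                                                  ∎
    where open ≡-Reasoning

infix 4 _≃_
record _≃_ (u v : Word) : Set where
  constructor ≃-intro
  field insertWord-≡ : ∀ Y → All Sorted Y → insertWord Y u ≡ insertWord Y v
open _≃_

≃-setoid : Setoid _ _
≃-setoid = record
  { Carrier       = Word
  ; _≈_           = _≃_
  ; isEquivalence = record
    { refl  = ≃-intro λ _ _ → refl
    ; sym   = λ u≃v → ≃-intro λ Y sorted → sym (insertWord-≡ u≃v Y sorted)
    ; trans = λ u≃v v≃w → ≃-intro λ Y sorted → trans (insertWord-≡ u≃v Y sorted) (insertWord-≡ v≃w Y sorted)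
    }
  }

open Setoid ≃-setoid using () renaming (refl to ≃-refl; reflexive to ≃-reflexive)
module ≃-Reasoning = SetoidReasoning ≃-setoid

≃-++ˡ : ∀ w {u v} → u ≃ v → w ++ u ≃ w ++ v
≃-++ˡ w {u} {v} u≃v = ≃-intro λ Y sorted → begin
  insertWord Y (w ++ u)              ≡⟨ insertWord-++ Y w u ⟩
  insertWord (insertWord Y w) u      ≡⟨ insertWord-≡ u≃v (insertWord Y w) (insertWord-sorted Y w sorted) ⟩
  insertWord (insertWord Y w) v      ≡⟨ insertWord-++ Y w v ⟨
  insertWord Y (w ++ v)              ∎
  where open ≡-Reasoning

≃-++ʳ : ∀ w {u v} → u ≃ v → u ++ w ≃ v ++ w
≃-++ʳ w {u} {v} u≃v = ≃-intro λ Y sorted → begin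
  insertWord Y (u ++ w)              ≡⟨ insertWord-++ Y u w ⟩
  insertWord (insertWord Y u) w      ≡⟨ cong (λ Z → insertWord Z w) (insertWord-≡ u≃v Y sorted) ⟩
  insertWord (insertWord Y v) w      ≡⟨ insertWord-++ Y v w ⟨
  insertWord Y (v ++ w)              ∎
  where open ≡-Reasoning

move⇒≃ : ∀ {u v} w → KnuthMove u v → u ++ w ≃ v ++ w
move⇒≃ w m = ≃-++ʳ w (≃-intro λ Y sorted → insertWord-resp-move Y sorted (fwd m))

sorted-++⁻ : ∀ L {M} → Sorted (L ++ M) → Sorted L × Sorted M
sorted-++⁻ []      sorted           = [] , sorted
sorted-++⁻ (x ∷ L) (x≤LM ∷ sorted) = map₁ (Allₚ.++⁻ˡ L x≤LM ∷_) (sorted-++⁻ L sorted)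

-- Reading words

row-∷ʳ-≃ : ∀ p H x → Sorted (p ∷ H) → x < p → p ∷ H ++ [ x ] ≃ p ∷ x ∷ H
row-∷ʳ-≃ p []      x _                     _   = ≃-refl
row-∷ʳ-≃ p (q ∷ H) x ((p≤q ∷ _) ∷ sorted) x<p = begin
  p ∷ q ∷ H ++ [ x ] ≈⟨ ≃-++ˡ [ p ] (row-∷ʳ-≃ q H x sorted (<-≤-trans x<p p≤q)) ⟩
  p ∷ q ∷ x ∷ H      ≈⟨ move⇒≃ H (bac~bca x<p p≤q) ⟨
  p ∷ x ∷ q ∷ H      ∎
  where open ≃-Reasoning

∷-row-≃ : ∀ L y b w → Sorted L → All (_≤ b) L → b < y → L ++ y ∷ b ∷ w ≃ y ∷ L ++ b ∷ w
∷-row-≃ []      y b w _              _          _   = ≃-refl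
∷-row-≃ (l ∷ L) y b w (l≤L ∷ sorted) (l≤b ∷ L≤b) b<y = begin
  l ∷ L ++ y ∷ b ∷ w   ≈⟨ ≃-++ˡ [ l ] (∷-row-≃ L y b w sorted L≤b b<y) ⟩
  l ∷ y ∷ L ++ b ∷ w   ≈⟨ swap L l≤L L≤b ⟩
  y ∷ l ∷ L ++ b ∷ w   ∎
  where
  open ≃-Reasoning
  swap : ∀ L → All (l ≤_) L → All (_≤ b) L → l ∷ y ∷ L ++ b ∷ w ≃ y ∷ l ∷ L ++ b ∷ w
  swap []       _           _            = move⇒≃ w (acb~cab l≤b b<y)
  swap (l′ ∷ L) (l≤l′ ∷ _) (l′≤b ∷ _) = move⇒≃ (L ++ b ∷ w) (acb~cab l≤l′ (≤-<-trans l′≤b b<y))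

bump-≃ : ∀ {x y S S′} → Sorted S → rowInsert x S ≡ (S′ , just y) → y ∷ S′ ≃ S ++ [ x ]
bump-≃ {x} {y} {S} sorted eq with bump⇒split x y S (cong proj₂ eq)
... | L , H , refl , S′-split , L≤x , x<y with sortedL , sorted-yH ← sorted-++⁻ L sorted
  rewrite trans (sym (cong proj₁ eq)) S′-split = begin
  y ∷ L ++ x ∷ H         ≈⟨ ∷-row-≃ L y x H sortedL L≤x x<y ⟨
  L ++ y ∷ x ∷ H         ≈⟨ ≃-++ˡ L (row-∷ʳ-≃ y H x sorted-yH x<y) ⟨
  L ++ y ∷ H ++ [ x ]    ≡⟨ ++-assoc L (y ∷ H) [ x ] ⟨
  (L ++ y ∷ H) ++ [ x ]  ∎
  where open ≃-Reasoning

readingWord-insert : ∀ x T → All Sorted T → readingWord (insert x T) ≃ readingWord T ++ [ x ]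
readingWord-insert x []      _                   = ≃-refl
readingWord-insert x (R ∷ T) (sortedR ∷ sortedT) with rowInsert x R in eq
... | R′ , nothing = begin
  readingWord T ++ R′            ≡⟨ cong (readingWord T ++_) R′-appended ⟩
  readingWord T ++ R ++ [ x ]    ≡⟨ ++-assoc (readingWord T) R [ x ] ⟨
  (readingWord T ++ R) ++ [ x ]  ∎
  where
  open ≃-Reasoning
  R′-appended : R′ ≡ R ++ [ x ]
  R′-appended = trans (sym (cong proj₁ eq)) (proj₂ (no-bump⇒appended x R (cong proj₂ eq)))
... | R′ , just y = begin
  readingWord (insert y T) ++ R′      ≈⟨ ≃-++ʳ R′ (readingWord-insert y T sortedT) ⟩
  (readingWord T ++ [ y ]) ++ R′      ≡⟨ ++-assoc (readingWord T) [ y ] R′ ⟩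
  readingWord T ++ y ∷ R′             ≈⟨ ≃-++ˡ (readingWord T) (bump-≃ sortedR eq) ⟩
  readingWord T ++ R ++ [ x ]         ≡⟨ ++-assoc (readingWord T) R [ x ] ⟨
  (readingWord T ++ R) ++ [ x ]       ∎
  where open ≃-Reasoning

readingWord-insertWord : ∀ T w → All Sorted T → readingWord (insertWord T w) ≃ readingWord T ++ w
readingWord-insertWord T []      _      = ≃-reflexive (sym (++-identityʳ (readingWord T)))
readingWord-insertWord T (x ∷ w) sorted = begin
  readingWord (insertWord (insert x T) w) ≈⟨ readingWord-insertWord (insert x T) w (insert-sorted x T sorted) ⟩
  readingWord (insert x T) ++ w           ≈⟨ ≃-++ʳ w (readingWord-insert x T sorted) ⟩
  (readingWord T ++ [ x ]) ++ w           ≡⟨ ++-assoc (readingWord T) [ x ] w ⟩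
  readingWord T ++ x ∷ w                  ∎
  where open ≃-Reasoning

P-sorted : ∀ w → All Sorted (P w)
P-sorted w = insertWord-sorted [] w []

#bigRows-prepend : ∀ s k u w → #bigRows s k (P w) ≤ #bigRows s k (P (u ++ w))
#bigRows-prepend s k u w =
  subst (#bigRows s k (P w) ≤_) (cong (#bigRows s k) Pu←readingWord)
        (#bigRows-readingWord s k (P u) (P w) (P-sorted u) (P-sorted w))
  where
  Pu←readingWord : insertWord (P u) (readingWord (P w)) ≡ P (u ++ w)
  Pu←readingWord = trans (insertWord-≡ (readingWord-insertWord [] w []) (P u) (P-sorted u))
                         (sym (insertWord-++ [] u w))

maxW-upper : ∀ u → All (_≤ maxW u) u
maxW-upper []      = []
maxW-upper (x ∷ u) = m≤m⊔n x (maxW u) ∷ All.map (λ y≤max → ≤-trans y≤max (m≤n⊔m x (maxW u))) (maxW-upper u)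

#big-All≤ : ∀ s u → All (_≤ s) u → #big s u ≡ 0
#big-All≤ s []      []           = refl
#big-All≤ s (x ∷ u) (x≤s ∷ u≤s) = cong₂ _+_ (big-≤ x≤s) (#big-All≤ s u u≤s)

#big≡0⇒All≤ : ∀ s R → #big s R ≡ 0 → All (_≤ s) R
#big≡0⇒All≤ s []      _     = []
#big≡0⇒All≤ s (x ∷ R) none with x ≤? s
... | yes x≤s = x≤s ∷ #big≡0⇒All≤ s R (trans (sym (cong (_+ #big s R) (big-≤ x≤s))) none)
... | no  x≰s = contradiction (trans (sym (cong (_+ #big s R) (big-> (≰⇒> x≰s)))) none) λ ()

#bigRows≡0⇒row≤ : ∀ s k T i → #bigRows s k T ≡ 0 → i < k → All (_≤ s) (row i T)
#bigRows≡0⇒row≤ s (suc k) []      i       _    _         = []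
#bigRows≡0⇒row≤ s (suc k) (R ∷ T) zero    none _         = #big≡0⇒All≤ s R (m+n≡0⇒m≡0 (#big s R) none)
#bigRows≡0⇒row≤ s (suc k) (R ∷ T) (suc i) none (s≤s i<k) =
  #bigRows≡0⇒row≤ s k T i (m+n≡0⇒n≡0 (#big s R) none) i<k

descending-positive⇒≤ : ∀ m k → All (1 ≤_) (descending m k) → k ≤ m
descending-positive⇒≤ m       zero    _         = z≤n
descending-positive⇒≤ (suc m) (suc k) (_ ∷ pos) = s≤s (descending-positive⇒≤ m k pos)

lemma2p3 : (u w : Word) → u ≢ [] → All (1 ≤_) u → All (1 ≤_) w →
    (u ++ w) ≡K (w ++ u) → (k : ℕ) → descending (maxW u) k ⊆ u →
    (i : ℕ) → i < k → All (_≤ maxW u) (row i (P w))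
lemma2p3 u w _ u-positive _ uw≡wu k run i i<k = #bigRows≡0⇒row≤ m k (P w) i no-big-entries i<k
  where
  m = maxW u
  lower : #bigRows m k (P w) ≤ #bigRows m k (insertWord (P w) u)
  lower = subst (#bigRows m k (P w) ≤_) (cong (#bigRows m k) (trans uw≡wu (insertWord-++ [] w u)))
                (#bigRows-prepend m k u w)
  upper : 0 < #bigRows m k (P w) → #bigRows m k (insertWord (P w) u) < #bigRows m k (P w) + #big m u
  upper = #bigRows-insertWord-< m k (P w) u (P-sorted w) (descending-positive⇒≤ m k (All-resp-⊆ run u-positive)) run
  no-big-entries : #bigRows m k (P w) ≡ 0
  no-big-entries = n≤0⇒n≡0 (≮⇒≥ λ pos → n≮n _ (begin-strict
    #bigRows m k (P w)                 ≤⟨ lower ⟩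
    #bigRows m k (insertWord (P w) u)  <⟨ upper pos ⟩
    #bigRows m k (P w) + #big m u      ≡⟨ cong (#bigRows m k (P w) +_) (#big-All≤ m u (maxW-upper u)) ⟩
    #bigRows m k (P w) + 0             ≡⟨ +-identityʳ _ ⟩
    #bigRows m k (P w)                 ∎))
    where open ≤-Reasoning
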